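{- Let $\mathcal{T}$ be an $r$-tree with vertex set $V=\{v_0,\dots,v_n\}$, equipped with a total order $\succ$ on $V$, and consider the toppled digraph of $(\mathcal{T},\succ)$. Suppose $\alpha$ is a recurrent configuration and $e$ is an edge of $\mathcal{T}$. Then for every toppling sequence from $\alpha$ back to $\alpha$ (i.e. the sequence of incidences along a directed closed walk of positive length through $\alpha$), all incidences $(w,e)$ with $w\in e$ occur the same number of times (possibly zero) in that sequence.
   Context: An $r$-tree is a connected $r$-uniform hypergraph (edges are $r$-subsets of $V$) with no cycles, where a cycle of length $s\ge2$ is $v_1e_1\cdots v_se_sv_1$ with distinct vertices, distinct edges, $v_i,v_{i+1}\in e_i$. An incidence is a pair $(v,e)$ with $v\in e\in E$. Let $d=(r-2)(n+1)+1$. A configuration is a function $\alpha:V\to\mathbb{Z}_{\ge0}$ with $\sum_v\alpha(v)=d$ (equivalently a monomial $\prod x_{v}^{\alpha(v)}$ of degree $d$). For $v\in V$ let $S_v$ be the set of configurations $\alpha$ with $\alpha(v)\ge r-1$ and $\alpha(w)<r-1$ for all $w\succ v$; every configuration lies in exactly one $S_v$. Toppling the incidence $(v,e)$ transforms $\alpha$ into $\alpha'$ with $\alpha'(v)=\alpha(v)-(r-1)$, $\alpha'(w)=\alpha(w)+1$ for $w\in e\setminus\{v\}$, and $\alpha'=\alpha$ elsewhere; it is allowed from $\alpha$ only if $\alpha\in S_v$. The toppled digraph has the configurations as vertices and an arc $\alpha\to\alpha'$ whenever $\alpha'$ is obtained from $\alpha$ by an allowed toppling. A configuration is recurrent if it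 lies on a directed closed walk of positive length in the toppled digraph. -}

module Defs where

open import Data.Nat using (ℕ; zero; suc; _+_; _*_; _∸_; _≤_; _<_; _≥_)
open import Data.Nat.DivMod using (_%_; m%n<n)
open import Data.Fin using (Fin; toℕ; fromℕ<; _≟_)
open import Data.Fin.Subset using (Subset; _∈_; ∣_∣)
open import Data.Fin.Subset.Properties using (_∈?_)
open import Data.List using (List; []; _∷_; tabulate)
open import Data.Nat.ListAction using (sum)
open import Data.Product using (Σ; ∃; ∃-syntax; _×_; _,_)
open import Function.Definitions using (Injective)
open import Relation.Binary.PropositionalEquality using (_≡_; _≢_)
open import Relation.Binary.Construct.Closure.ReflexiveTransitive using (Star)
open import Relation.Nullary using (yes; no; ¬_)

-- A hypergraph with m edges, indexed by Fin m: edge i is a subset of V.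
-- Distinct indices give distinct edges (injectivity), so the edge set is a set.

nextIdx : {k : ℕ} → Fin (suc (suc k)) → Fin (suc (suc k))
nextIdx {k} i = fromℕ< (m%n<n (suc (toℕ i)) (suc (suc k)))

-- a cycle of length s = k + 2 ≥ 2: v_1 e_1 ... v_s e_s v_1 with distinct
-- vertices, distinct edges, and v_i , v_{i+1} ∈ e_i (indices mod s)
HasCycle : {n m : ℕ} → (Fin m → Subset (suc n)) → Set
HasCycle {n} {m} edge =
  ∃[ k ] Σ (Fin (suc (suc k)) → Fin (suc n)) λ v →
         Σ (Fin (suc (suc k)) → Fin m) λ f →
           Injective _≡_ _≡_ v × Injective _≡_ _≡_ f ×
           (∀ i → v i ∈ edge (f i)) × (∀ i → v (nextIdx i) ∈ edge (f i))

Adj : {n m : ℕ} → (Fin m → Subset (suc n)) → Fin (suc n) → Fin (suc n) → Set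
Adj edge u w = ∃[ e ] (u ∈ edge e × w ∈ edge e)

Connected : {n m : ℕ} → (Fin m → Subset (suc n)) → Set
Connected {n} edge = ∀ (u w : Fin (suc n)) → Star (Adj edge) u w

record IsRTree (r n m : ℕ) (edge : Fin m → Subset (suc n)) : Set where
  field
    edgeSize  : ∀ e → ∣ edge e ∣ ≡ r
    distinct  : Injective _≡_ _≡_ edge
    connected : Connected edge
    acyclic   : ¬ HasCycle edge

degree : ℕ → ℕ → ℕ
degree r n = (r ∸ 2) * (suc n) + 1

Config : ℕ → Set
Config n = Fin (suc n) → ℕ

IsConfiguration : (r n : ℕ) → Config n → Set
IsConfiguration r n α = sum (tabulate α) ≡ degree r n

InS : {n : ℕ} (r : ℕ) (_≻_ : Fin (suc n) → Fin (suc n) → Set) →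
      Config n → Fin (suc n) → Set
InS {n} r _≻_ α v = (α v ≥ r ∸ 1) × (∀ (w : Fin (suc n)) → w ≻ v → α w < r ∸ 1)

topple : {n m : ℕ} (r : ℕ) (edge : Fin m → Subset (suc n)) →
         Config n → Fin (suc n) → Fin m → Config n
topple r edge α v e w with w ≟ v
... | yes _ = α w ∸ (r ∸ 1)
... | no _ with w ∈? edge e
...   | yes _ = α w + 1
...   | no _  = α w

Incidence : ℕ → ℕ → Set
Incidence n m = Fin (suc n) × Fin m

-- allowed-toppling walks in the toppled digraph, recording the incidences used
data Walk {n m : ℕ} (r : ℕ) (edge : Fin m → Subset (suc n))
          (_≻_ : Fin (suc n) → Fin (suc n) → Set) :
          Config n → Config n → List (Incidence n m) → Set where
  [] : ∀ {α} → Walk r edge _≻_ α α []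
  step : ∀ {α β is} (v : Fin (suc n)) (e : Fin m) →
         v ∈ edge e → InS r _≻_ α v →
         Walk r edge _≻_ (topple r edge α v e) β is →
         Walk r edge _≻_ α β ((v , e) ∷ is)

ClosedWalk : {n m : ℕ} (r : ℕ) (edge : Fin m → Subset (suc n))
             (_≻_ : Fin (suc n) → Fin (suc n) → Set) →
             Config n → List (Incidence n m) → Set
ClosedWalk r edge _≻_ α is = Walk r edge _≻_ α α is × is ≢ []

Recurrent : {n m : ℕ} (r : ℕ) (edge : Fin m → Subset (suc n))
            (_≻_ : Fin (suc n) → Fin (suc n) → Set) → Config n → Set
Recurrent {n} {m} r edge _≻_ α = ∃[ is ] ClosedWalk {n} {m} r edge _≻_ α is

occ : {n m : ℕ} → Fin (suc n) → Fin m → List (Incidence n m) → ℕ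
occ w e [] = 0
occ w e ((v , f) ∷ is) with v ≟ w | f ≟ e
... | yes _ | yes _ = suc (occ w e is)
... | _     | _     = occ w e is

{-# OPTIONS --safe #-}
module Submission where

open import Defs
open import Data.Nat using (ℕ; zero; suc; _+_; _*_; _∸_; _≤_; _<_; z≤n; s≤s; z<s; _<?_)
open import Data.Nat.Properties hiding (_≟_)
open import Data.Nat.DivMod using (_%_; m%n<n; m<n⇒m%n≡m; n%n≡0)
open import Algebra.Properties.Semiring.Sum +-*-semiring
  using (sum; sum-cong-≗; sum-remove; sum-replicate-zero; *-distribˡ-sum; *-distribʳ-sum; ∑-distrib-+)
open import Algebra.Properties.CommutativeSemigroup +-commutativeSemigroup using (xy∙z≈xz∙y)
open import Data.Fin as Fin using (Fin; toℕ; _≟_; punchIn)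
open import Data.Fin.Properties
  using (any?; punchInᵢ≢i; toℕ-injective; toℕ<n; toℕ-fromℕ<; pigeonhole)
open import Data.Fin.Subset using (Subset; _∈_; ∣_∣; inside; outside)
open import Data.Fin.Subset.Properties using (_∈?_)
open import Data.Vec using ([]; _∷_)
open import Data.Bool using (if_then_else_)
open import Data.List using (List; []; _∷_)
open import Data.Product using (Σ; ∃; ∃-syntax; _,_; _×_; proj₁; proj₂; uncurry)
open import Data.Sum using (inj₁; inj₂)
open import Function using (_∘_)
open import Relation.Binary.PropositionalEquality
open import Relation.Binary.Structures using (IsStrictTotalOrder)
open import Relation.Nullary using (Dec; does; yes; no; ¬_; contradiction)
open import Relation.Nullary.Decidable using (dec-true; dec-false)

-- Write r = q + 1, let x(u, f) be the number of topplings of the incidence (u, f) in the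
-- closed walk and T(f) = Σ_u x(u, f) the number of topplings at the edge f.  Since the walk
-- returns to its start, counting chips at a vertex u gives Σ_{f ∋ u} r x(u, f) = Σ_{f ∋ u} T(f),
-- and since |f| = r also Σ_{u ∈ f} r x(u, f) = Σ_{u ∈ f} T(f).  Call (u, f) an excess pair if
-- r x(u, f) > T(f) and a deficit pair if r x(u, f) < T(f).  By the second identity an excess
-- pair (u, f) yields a deficit pair (u′, f), and by the first that yields an excess pair
-- (u′, f′).  Alternating forever gives a walk in the hypergraph that never immediately reuses a
-- vertex or an edge; the first repetition of a vertex or an edge along it closes a cycle.  So a
-- tree has no excess pairs, and then the second identity forces r x(u, f) = T(f) for all u ∈ f.

⟦_⟧ : {A : Set} → Dec A → ℕ
⟦ a? ⟧ = if does a? then 1 else 0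

⟦⟧-true : {A : Set} (a? : Dec A) → A → ⟦ a? ⟧ ≡ 1
⟦⟧-true a? a rewrite dec-true a? a = refl

⟦⟧-false : {A : Set} (a? : Dec A) → ¬ A → ⟦ a? ⟧ ≡ 0
⟦⟧-false a? ¬a rewrite dec-false a? ¬a = refl

⟦⟧*-true : {A : Set} (a? : Dec A) → A → ∀ c → ⟦ a? ⟧ * c ≡ c
⟦⟧*-true a? a c = trans (cong (_* c) (⟦⟧-true a? a)) (*-identityˡ c)

⟦⟧*-positive : {A : Set} (a? : Dec A) {b c : ℕ} → b < ⟦ a? ⟧ * c → A
⟦⟧*-positive (yes a) _  = a
⟦⟧*-positive (no _)  ()

⟦⟧*-≤ : {A : Set} (a? : Dec A) (c : ℕ) → ⟦ a? ⟧ * c ≤ c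
⟦⟧*-≤ (yes _) c = ≤-reflexive (*-identityˡ c)
⟦⟧*-≤ (no _)  c = z≤n

sum-pointMass : ∀ {k} (t : Fin k → ℕ) i → (∀ j → j ≢ i → t j ≡ 0) → sum t ≡ t i
sum-pointMass {suc k} t i elsewhere = begin
  sum t                             ≡⟨ sum-remove t ⟩
  t i + sum (λ j → t (punchIn i j)) ≡⟨ cong (t i +_) (sum-cong-≗ (elsewhere _ ∘ punchInᵢ≢i i)) ⟩
  t i + sum {k} (λ _ → 0)           ≡⟨ cong (t i +_) (sum-replicate-zero k) ⟩
  t i + 0                           ≡⟨ +-identityʳ (t i) ⟩
  t i                               ∎
  where open ≡-Reasoning

sum-⟦≟⟧* : ∀ {k} (i : Fin k) (g : Fin k → ℕ) → sum (λ j → ⟦ i ≟ j ⟧ * g j) ≡ g i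
sum-⟦≟⟧* i g =
  trans (sum-pointMass _ i (λ j j≢i → cong (_* g j) (⟦⟧-false (i ≟ j) (j≢i ∘ sym))))
        (⟦⟧*-true (i ≟ i) refl (g i))

sum-⟦∈?⟧ : ∀ {k} (p : Subset k) → sum (λ i → ⟦ i ∈? p ⟧) ≡ ∣ p ∣
sum-⟦∈?⟧ []            = refl
sum-⟦∈?⟧ (inside ∷ p)  = cong suc (sum-⟦∈?⟧ p)
sum-⟦∈?⟧ (outside ∷ p) = sum-⟦∈?⟧ p

sum-mono-≤ : ∀ {k} {f g : Fin k → ℕ} → (∀ i → f i ≤ g i) → sum f ≤ sum g
sum-mono-≤ {zero}  f≤g = z≤n
sum-mono-≤ {suc k} f≤g = +-mono-≤ (f≤g Fin.zero) (sum-mono-≤ (f≤g ∘ Fin.suc))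

sum-≡∧≤⇒≡ : ∀ {k} {f g : Fin k → ℕ} →
  sum f ≡ sum g → (∀ i → f i ≤ g i) → ∀ i → f i ≡ g i
sum-≡∧≤⇒≡ {suc k} {f} {g} Σf≡Σg f≤g = pointwise
  where
  tails-≤ : sum (f ∘ Fin.suc) ≤ sum (g ∘ Fin.suc)
  tails-≤ = sum-mono-≤ (f≤g ∘ Fin.suc)
  heads-≡ : f Fin.zero ≡ g Fin.zero
  heads-≡ = ≤-antisym (f≤g Fin.zero)
    (+-cancelʳ-≤ _ _ _ (≤-trans (≤-reflexive (sym Σf≡Σg)) (+-monoʳ-≤ (f Fin.zero) tails-≤)))
  tails-≡ : sum (f ∘ Fin.suc) ≡ sum (g ∘ Fin.suc)
  tails-≡ = +-cancelˡ-≡ (f Fin.zero) _ _ (trans Σf≡Σg (cong (_+ _) (sym heads-≡)))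
  pointwise : ∀ i → f i ≡ g i
  pointwise Fin.zero    = heads-≡
  pointwise (Fin.suc i) = sum-≡∧≤⇒≡ tails-≡ (f≤g ∘ Fin.suc) i

sum-≡⇒∃< : ∀ {k} {f g : Fin k → ℕ} →
  sum f ≡ sum g → ∀ i → g i < f i → ∃ λ j → f j < g j
sum-≡⇒∃< {f = f} {g} Σf≡Σg i gi<fi with any? (λ j → f j <? g j)
... | yes f<g = f<g
... | no ¬f<g = contradiction (sum-≡∧≤⇒≡ (sym Σf≡Σg) g≤f i) (<⇒≢ gi<fi)
  where
  g≤f : ∀ j → g j ≤ f j
  g≤f j = ≮⇒≥ (λ fj<gj → ¬f<g (j , fj<gj))

InjectiveBelow : {A : Set} → ℕ → (ℕ → A) → Set
InjectiveBelow k f = ∀ {a b} → a < k → b < k → f a ≡ f b → a ≡ b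

injectiveBelow-one : {A : Set} (f : ℕ → A) → InjectiveBelow 1 f
injectiveBelow-one f (s≤s z≤n) (s≤s z≤n) _ = refl

injectiveBelow-offset : {A : Set} {f : ℕ → A} {j k : ℕ} (a : ℕ) →
  InjectiveBelow j f → k + a ≤ j → InjectiveBelow k (f ∘ (_+ a))
injectiveBelow-offset a inj k+a≤j x<k y<k eq =
  +-cancelʳ-≡ a _ _ (inj (shifted x<k) (shifted y<k) eq)
  where
  shifted : ∀ {x} → x < _ → x + a < _
  shifted x<k = <-≤-trans (+-monoˡ-< a x<k) k+a≤j

injectiveBelow-tail : {A : Set} {f : ℕ → A} {k : ℕ} →
  InjectiveBelow (suc k) f → InjectiveBelow k (f ∘ suc)
injectiveBelow-tail inj x<k y<k eq = suc-injective (inj (s≤s x<k) (s≤s y<k) eq)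

injectiveBelow-extend : {A : Set} {f : ℕ → A} {k : ℕ} →
  InjectiveBelow k f → (∀ {a} → a < k → f k ≢ f a) → InjectiveBelow (suc k) f
injectiveBelow-extend inj new x<1+k y<1+k eq
  with m<1+n⇒m<n∨m≡n x<1+k | m<1+n⇒m<n∨m≡n y<1+k
... | inj₁ x<k  | inj₁ y<k  = inj x<k y<k eq
... | inj₁ x<k  | inj₂ refl = contradiction (sym eq) (new x<k)
... | inj₂ refl | inj₁ y<k  = contradiction eq (new y<k)
... | inj₂ refl | inj₂ refl = refl

injectiveBelow-rotate : {A : Set} {f : ℕ → A} {k : ℕ} →
  InjectiveBelow (suc k) f → f (suc k) ≡ f 0 → InjectiveBelow (suc k) (f ∘ suc)
injectiveBelow-rotate inj period x<1+k y<1+k eq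
  with m≤n⇒m<n∨m≡n x<1+k | m≤n⇒m<n∨m≡n y<1+k
... | inj₁ 1+x<1+k | inj₁ 1+y<1+k = suc-injective (inj 1+x<1+k 1+y<1+k eq)
... | inj₁ 1+x<1+k | inj₂ refl    = contradiction (inj 1+x<1+k z<s (trans eq period)) λ ()
... | inj₂ refl    | inj₁ 1+y<1+k = contradiction (inj 1+y<1+k z<s (trans (sym eq) period)) λ ()
... | inj₂ refl    | inj₂ refl    = refl

¬injectiveBelow-suc : ∀ {n} (f : ℕ → Fin n) → ¬ InjectiveBelow (suc n) f
¬injectiveBelow-suc {n} f inj with pigeonhole (n<1+n n) (f ∘ toℕ)
... | i , j , i<j , fi≡fj = <-irrefl (inj (toℕ<n i) (toℕ<n j) fi≡fj) i<j

<-byOffset : {P : ℕ → ℕ → Set} → (∀ a d → P a (suc d + a)) → ∀ {a k} → a < k → P a k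
<-byOffset {P} p {a} a<k with m≤n⇒∃[o]m+o≡n a<k
... | d , 1+a+d≡k = subst (P a) (trans (cong suc (+-comm d a)) 1+a+d≡k) (p a d)

record NonBacktrackingWalk {n m : ℕ} (edge : Fin m → Subset (suc n)) : Set where
  field
    vertexAt     : ℕ → Fin (suc n)
    edgeAt       : ℕ → Fin m
    vertex∈      : ∀ k → vertexAt k ∈ edge (edgeAt k)
    next∈        : ∀ k → vertexAt (suc k) ∈ edge (edgeAt k)
    vertex-turns : ∀ k → vertexAt (suc k) ≢ vertexAt k
    edge-turns   : ∀ k → edgeAt (suc k) ≢ edgeAt k

module _ {n m : ℕ} {edge : Fin m → Subset (suc n)} where

  toℕ-nextIdx-< : ∀ {k} (i : Fin (suc (suc k))) →
    suc (toℕ i) < suc (suc k) → toℕ (nextIdx i) ≡ suc (toℕ i)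
  toℕ-nextIdx-< {k} i lt = trans (toℕ-fromℕ< (m%n<n (suc (toℕ i)) (suc (suc k)))) (m<n⇒m%n≡m lt)

  toℕ-nextIdx-last : ∀ {k} (i : Fin (suc (suc k))) →
    suc (toℕ i) ≡ suc (suc k) → toℕ (nextIdx i) ≡ 0
  toℕ-nextIdx-last {k} i eq =
    trans (toℕ-fromℕ< (m%n<n (suc (toℕ i)) (suc (suc k))))
          (trans (cong (_% suc (suc k)) eq) (n%n≡0 (suc (suc k))))

  closedWalk⇒cycle : (ℓ : ℕ) (V : ℕ → Fin (suc n)) (G : ℕ → Fin m) →
    (∀ t → V t ∈ edge (G t)) → (∀ t → V (suc t) ∈ edge (G t)) → V 0 ∈ edge (G (suc ℓ)) →
    InjectiveBelow (suc (suc ℓ)) V → InjectiveBelow (suc (suc ℓ)) G → HasCycle edge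
  closedWalk⇒cycle ℓ V G V∈G next∈G closes V-inj G-inj =
    ℓ , V ∘ toℕ , G ∘ toℕ ,
    (λ {i} {j} eq → toℕ-injective (V-inj (toℕ<n i) (toℕ<n j) eq)) ,
    (λ {i} {j} eq → toℕ-injective (G-inj (toℕ<n i) (toℕ<n j) eq)) ,
    V∈G ∘ toℕ , successor∈
    where
    successor∈ : ∀ i → V (toℕ (nextIdx i)) ∈ edge (G (toℕ i))
    successor∈ i with m<1+n⇒m<n∨m≡n (s≤s (toℕ<n i))
    ... | inj₁ lt = subst (λ j → V j ∈ edge (G (toℕ i))) (sym (toℕ-nextIdx-< i lt)) (next∈G (toℕ i))
    ... | inj₂ eq = subst₂ (λ j f → V j ∈ edge (G f))
                      (sym (toℕ-nextIdx-last i eq)) (sym (suc-injective eq)) closes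

  module _ (acyclic : ¬ HasCycle edge) (W : NonBacktrackingWalk edge) where
    open NonBacktrackingWalk W

    vertex-noReturn : ∀ a d →
      InjectiveBelow (suc d + a) vertexAt → InjectiveBelow (suc d + a) edgeAt →
      vertexAt (suc d + a) ≢ vertexAt a
    vertex-noReturn a zero    _ _ = vertex-turns a
    vertex-noReturn a (suc ℓ) vertex-inj edge-inj returns =
      acyclic (closedWalk⇒cycle ℓ (vertexAt ∘ (_+ a)) (edgeAt ∘ (_+ a))
                 (vertex∈ ∘ (_+ a)) (next∈ ∘ (_+ a))
                 (subst (λ v → v ∈ edge (edgeAt (suc ℓ + a))) returns (next∈ (suc ℓ + a)))
                 (injectiveBelow-offset a vertex-inj ≤-refl)
                 (injectiveBelow-offset a edge-inj ≤-refl))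

    -- The cycle starts at the vertex after the first visit of the repeated edge, and the
    -- repeated edge is its last edge.
    edge-noReturn : ∀ a d →
      InjectiveBelow (suc (suc d + a)) vertexAt → InjectiveBelow (suc d + a) edgeAt →
      edgeAt (suc d + a) ≢ edgeAt a
    edge-noReturn a zero    _ _ = edge-turns a
    edge-noReturn a (suc ℓ) vertex-inj edge-inj returns =
      acyclic (closedWalk⇒cycle ℓ (vertexAt ∘ (_+ a) ∘ suc) (edgeAt ∘ (_+ a) ∘ suc)
                 (vertex∈ ∘ (_+ a) ∘ suc) (next∈ ∘ (_+ a) ∘ suc)
                 (subst (λ f → vertexAt (suc a) ∈ edge f) (sym returns) (next∈ a))
                 (injectiveBelow-tail (injectiveBelow-offset a vertex-inj ≤-refl))
                 (injectiveBelow-rotate (injectiveBelow-offset a edge-inj ≤-refl) returns))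

    vertex-fresh : ∀ {a k} → a < k →
      InjectiveBelow k vertexAt → InjectiveBelow k edgeAt → vertexAt k ≢ vertexAt a
    vertex-fresh = <-byOffset
      {λ a k → InjectiveBelow k vertexAt → InjectiveBelow k edgeAt → vertexAt k ≢ vertexAt a}
      vertex-noReturn

    edge-fresh : ∀ {a k} → a < k →
      InjectiveBelow (suc k) vertexAt → InjectiveBelow k edgeAt → edgeAt k ≢ edgeAt a
    edge-fresh = <-byOffset
      {λ a k → InjectiveBelow (suc k) vertexAt → InjectiveBelow k edgeAt → edgeAt k ≢ edgeAt a}
      edge-noReturn

    injectivePrefix : ∀ k → InjectiveBelow (suc k) vertexAt × InjectiveBelow (suc k) edgeAt
    injectivePrefix zero    = injectiveBelow-one vertexAt , injectiveBelow-one edgeAt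
    injectivePrefix (suc k) with injectivePrefix k
    ... | vertex-inj , edge-inj =
      vertex-inj′ , injectiveBelow-extend edge-inj (λ a<k → edge-fresh a<k vertex-inj′ edge-inj)
      where
      vertex-inj′ : InjectiveBelow (suc (suc k)) vertexAt
      vertex-inj′ = injectiveBelow-extend vertex-inj (λ a<k → vertex-fresh a<k vertex-inj edge-inj)

  acyclic⇒¬nonBacktrackingWalk : ¬ HasCycle edge → ¬ NonBacktrackingWalk edge
  acyclic⇒¬nonBacktrackingWalk acyclic W =
    ¬injectiveBelow-suc (NonBacktrackingWalk.vertexAt W) (proj₁ (injectivePrefix acyclic W (suc n)))

  alternatingWalk : (Excess Deficit : Fin (suc n) → Fin m → Set) →
    (∀ {u f} → Excess u f → u ∈ edge f) → (∀ {u f} → Deficit u f → u ∈ edge f) →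
    (∀ {u f} → Excess u f → ¬ Deficit u f) →
    (∀ {u f} → Excess u f → ∃[ u′ ] Deficit u′ f) →
    (∀ {u f} → Deficit u f → ∃[ f′ ] Excess u f′) →
    ∀ {u f} → Excess u f → NonBacktrackingWalk edge
  alternatingWalk Excess Deficit excess∈ deficit∈ exclusive excess⇒deficit deficit⇒excess
                  {u} {f} excess = record
    { vertexAt     = vertexAt
    ; edgeAt       = edgeAt
    ; vertex∈      = excess∈ ∘ excessAt
    ; next∈        = deficit∈ ∘ deficitAt
    ; vertex-turns = λ k returns →
        exclusive (excessAt k) (subst (λ v → Deficit v (edgeAt k)) returns (deficitAt k))
    ; edge-turns   = λ k returns →
        exclusive (subst (Excess (vertexAt (suc k))) returns (excessAt (suc k))) (deficitAt k)
    }
    where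
    state : ℕ → Σ (Fin (suc n) × Fin m) (uncurry Excess)
    state zero    = (u , f) , excess
    state (suc k) with excess⇒deficit (proj₂ (state k))
    ... | u′ , deficit = (u′ , proj₁ (deficit⇒excess deficit)) , proj₂ (deficit⇒excess deficit)
    vertexAt : ℕ → Fin (suc n)
    vertexAt = proj₁ ∘ proj₁ ∘ state
    edgeAt : ℕ → Fin m
    edgeAt = proj₂ ∘ proj₁ ∘ state
    excessAt : ∀ k → Excess (vertexAt k) (edgeAt k)
    excessAt = proj₂ ∘ state
    deficitAt : ∀ k → Deficit (vertexAt (suc k)) (edgeAt k)
    deficitAt k = proj₂ (excess⇒deficit (excessAt k))

module _ {n m : ℕ} where

  occ-∷ : ∀ u f v e (is : List (Incidence n m)) →
    occ u f ((v , e) ∷ is) ≡ ⟦ v ≟ u ⟧ * ⟦ e ≟ f ⟧ + occ u f is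
  occ-∷ u f v e is with v ≟ u | e ≟ f
  ... | yes _ | yes _ = refl
  ... | yes _ | no _  = refl
  ... | no _  | _     = refl

  firings : Fin (suc n) → List (Incidence n m) → ℕ
  firings u []             = 0
  firings u ((v , e) ∷ is) = ⟦ v ≟ u ⟧ + firings u is

  topplings : Fin m → List (Incidence n m) → ℕ
  topplings f is = sum (λ v → occ v f is)

  firings≡∑occ : ∀ u is → firings u is ≡ sum (λ f → occ u f is)
  firings≡∑occ u []             = sym (sum-replicate-zero m)
  firings≡∑occ u ((v , e) ∷ is) = sym (begin
    sum (λ f → occ u f ((v , e) ∷ is))
      ≡⟨ sum-cong-≗ (λ f → occ-∷ u f v e is) ⟩
    sum (λ f → ⟦ v ≟ u ⟧ * ⟦ e ≟ f ⟧ + occ u f is)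
      ≡⟨ ∑-distrib-+ (λ f → ⟦ v ≟ u ⟧ * ⟦ e ≟ f ⟧) (λ f → occ u f is) ⟩
    sum (λ f → ⟦ v ≟ u ⟧ * ⟦ e ≟ f ⟧) + sum (λ f → occ u f is)
      ≡⟨ cong₂ _+_ fired (sym (firings≡∑occ u is)) ⟩
    ⟦ v ≟ u ⟧ + firings u is
      ∎)
    where
    open ≡-Reasoning
    fired : sum (λ f → ⟦ v ≟ u ⟧ * ⟦ e ≟ f ⟧) ≡ ⟦ v ≟ u ⟧
    fired = trans (sum-cong-≗ (λ f → *-comm ⟦ v ≟ u ⟧ ⟦ e ≟ f ⟧))
                  (sum-⟦≟⟧* e (λ _ → ⟦ v ≟ u ⟧))

  topplings-∷ : ∀ f v e is → topplings f ((v , e) ∷ is) ≡ ⟦ e ≟ f ⟧ + topplings f is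
  topplings-∷ f v e is = begin
    sum (λ u → occ u f ((v , e) ∷ is))
      ≡⟨ sum-cong-≗ (λ u → occ-∷ u f v e is) ⟩
    sum (λ u → ⟦ v ≟ u ⟧ * ⟦ e ≟ f ⟧ + occ u f is)
      ≡⟨ ∑-distrib-+ (λ u → ⟦ v ≟ u ⟧ * ⟦ e ≟ f ⟧) (λ u → occ u f is) ⟩
    sum (λ u → ⟦ v ≟ u ⟧ * ⟦ e ≟ f ⟧) + topplings f is
      ≡⟨ cong (_+ topplings f is) (sum-⟦≟⟧* v (λ _ → ⟦ e ≟ f ⟧)) ⟩
    ⟦ e ≟ f ⟧ + topplings f is
      ∎
    where open ≡-Reasoning

  module _ (edge : Fin m → Subset (suc n)) where

    -- The toppling vertex itself counts as receiving a chip; in exchange a firing is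
    -- charged r chips instead of r − 1 (see walk-conserves).
    chipsReceived : Fin (suc n) → List (Incidence n m) → ℕ
    chipsReceived u []             = 0
    chipsReceived u ((v , e) ∷ is) = ⟦ u ∈? edge e ⟧ + chipsReceived u is

    chipsReceived≡∑topplings : ∀ u is →
      chipsReceived u is ≡ sum (λ f → ⟦ u ∈? edge f ⟧ * topplings f is)
    chipsReceived≡∑topplings u [] = sym (begin
      sum (λ f → ⟦ u ∈? edge f ⟧ * topplings f [])
        ≡⟨ sum-cong-≗ (λ f → trans (cong (⟦ u ∈? edge f ⟧ *_) (sum-replicate-zero (suc n)))
                                   (*-zeroʳ ⟦ u ∈? edge f ⟧)) ⟩
      sum {m} (λ _ → 0)
        ≡⟨ sum-replicate-zero m ⟩
      0 ∎)
      where open ≡-Reasoning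
    chipsReceived≡∑topplings u ((v , e) ∷ is) = sym (begin
      sum (λ f → ⟦ u ∈? edge f ⟧ * topplings f ((v , e) ∷ is))
        ≡⟨ sum-cong-≗ (λ f → trans (cong (⟦ u ∈? edge f ⟧ *_) (topplings-∷ f v e is))
                                   (*-distribˡ-+ ⟦ u ∈? edge f ⟧ _ _)) ⟩
      sum (λ f → ⟦ u ∈? edge f ⟧ * ⟦ e ≟ f ⟧ + ⟦ u ∈? edge f ⟧ * topplings f is)
        ≡⟨ ∑-distrib-+ (λ f → ⟦ u ∈? edge f ⟧ * ⟦ e ≟ f ⟧) (λ f → ⟦ u ∈? edge f ⟧ * topplings f is) ⟩
      sum (λ f → ⟦ u ∈? edge f ⟧ * ⟦ e ≟ f ⟧) + sum (λ f → ⟦ u ∈? edge f ⟧ * topplings f is)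
        ≡⟨ cong₂ _+_ received (sym (chipsReceived≡∑topplings u is)) ⟩
      ⟦ u ∈? edge e ⟧ + chipsReceived u is
        ∎)
      where
      open ≡-Reasoning
      received : sum (λ f → ⟦ u ∈? edge f ⟧ * ⟦ e ≟ f ⟧) ≡ ⟦ u ∈? edge e ⟧
      received = trans (sum-cong-≗ (λ f → *-comm ⟦ u ∈? edge f ⟧ ⟦ e ≟ f ⟧))
                       (sum-⟦≟⟧* e (λ f → ⟦ u ∈? edge f ⟧))

    occ-∉ : ∀ {r _≻_ α β is} → Walk r edge _≻_ α β is →
      ∀ {u f} → ¬ u ∈ edge f → occ u f is ≡ 0
    occ-∉ []                           u∉f = refl
    occ-∉ (step v e v∈e _ W) {u} {f} u∉f with v ≟ u | e ≟ f
    ... | yes refl | yes refl = contradiction v∈e u∉f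
    ... | yes _    | no _     = occ-∉ W u∉f
    ... | no _     | _        = occ-∉ W u∉f

    module _ (q : ℕ) where

      topple-conserves : ∀ α v e u → v ∈ edge e → q ≤ α v →
        α u + ⟦ u ∈? edge e ⟧ ≡ topple (suc q) edge α v e u + suc q * ⟦ v ≟ u ⟧
      topple-conserves α v e u v∈e q≤αv with u ≟ v
      ... | yes refl rewrite ⟦⟧-true (v ∈? edge e) v∈e | ⟦⟧-true (v ≟ v) refl = begin
        α v + 1              ≡⟨ cong (_+ 1) (m∸n+n≡m q≤αv) ⟨
        α v ∸ q + q + 1      ≡⟨ +-assoc (α v ∸ q) q 1 ⟩
        α v ∸ q + (q + 1)    ≡⟨ cong (α v ∸ q +_) (+-comm q 1) ⟩
        α v ∸ q + suc q      ≡⟨ cong (α v ∸ q +_) (*-identityʳ (suc q)) ⟨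
        α v ∸ q + suc q * 1  ∎
        where open ≡-Reasoning
      ... | no u≢v rewrite ⟦⟧-false (v ≟ u) (u≢v ∘ sym) | *-zeroʳ q with u ∈? edge e
      ...   | yes _ = sym (+-identityʳ (α u + 1))
      ...   | no _  = refl

      walk-conserves : ∀ {_≻_ α β is} → Walk (suc q) edge _≻_ α β is → ∀ u →
        α u + chipsReceived u is ≡ β u + suc q * firings u is
      walk-conserves {α = α} [] u = cong (α u +_) (sym (*-zeroʳ (suc q)))
      walk-conserves {α = α} {β} (step v e v∈e (q≤αv , _) W) u =
        compose {α u} {topple (suc q) edge α v e u} {β u}
          (topple-conserves α v e u v∈e q≤αv) (walk-conserves W u)
        where
        compose : ∀ {x y z a b c d} → x + a ≡ y + suc q * b → y + c ≡ z + suc q * d →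
                  x + (a + c) ≡ z + suc q * (b + d)
        compose {x} {y} {z} {a} {b} {c} {d} first rest = begin
          x + (a + c)                  ≡⟨ +-assoc x a c ⟨
          x + a + c                    ≡⟨ cong (_+ c) first ⟩
          y + suc q * b + c            ≡⟨ xy∙z≈xz∙y y (suc q * b) c ⟩
          y + c + suc q * b            ≡⟨ cong (_+ suc q * b) rest ⟩
          z + suc q * d + suc q * b    ≡⟨ +-assoc z (suc q * d) (suc q * b) ⟩
          z + (suc q * d + suc q * b)  ≡⟨ cong (z +_) (+-comm (suc q * d) (suc q * b)) ⟩
          z + (suc q * b + suc q * d)  ≡⟨ cong (z +_) (*-distribˡ-+ (suc q) b d) ⟨
          z + suc q * (b + d)          ∎
          where open ≡-Reasoning

      vertex-balance : ∀ {_≻_ α is} → Walk (suc q) edge _≻_ α α is → ∀ u →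
        sum (λ f → suc q * occ u f is) ≡ sum (λ f → ⟦ u ∈? edge f ⟧ * topplings f is)
      vertex-balance {α = α} {is} W u = begin
        sum (λ f → suc q * occ u f is)                ≡⟨ *-distribˡ-sum (suc q) (λ f → occ u f is) ⟨
        suc q * sum (λ f → occ u f is)                ≡⟨ cong (suc q *_) (firings≡∑occ u is) ⟨
        suc q * firings u is                          ≡⟨ +-cancelˡ-≡ (α u) _ _ (walk-conserves W u) ⟨
        chipsReceived u is                            ≡⟨ chipsReceived≡∑topplings u is ⟩
        sum (λ f → ⟦ u ∈? edge f ⟧ * topplings f is)  ∎
        where open ≡-Reasoning

      edge-balance : ∀ f is → ∣ edge f ∣ ≡ suc q →
        sum (λ v → suc q * occ v f is) ≡ sum (λ v → ⟦ v ∈? edge f ⟧ * topplings f is)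
      edge-balance f is size = begin
        sum (λ v → suc q * occ v f is)
          ≡⟨ *-distribˡ-sum (suc q) (λ v → occ v f is) ⟨
        suc q * topplings f is
          ≡⟨ cong (_* topplings f is) size ⟨
        ∣ edge f ∣ * topplings f is
          ≡⟨ cong (_* topplings f is) (sum-⟦∈?⟧ (edge f)) ⟨
        sum (λ v → ⟦ v ∈? edge f ⟧) * topplings f is
          ≡⟨ *-distribʳ-sum (topplings f is) (λ v → ⟦ v ∈? edge f ⟧) ⟩
        sum (λ v → ⟦ v ∈? edge f ⟧ * topplings f is)
          ∎
        where open ≡-Reasoning

      module OnClosedWalk (acyclic : ¬ HasCycle edge) (size : ∀ f → ∣ edge f ∣ ≡ suc q)
                          {_≻_ α is} (W : Walk (suc q) edge _≻_ α α is) where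

        Excess Deficit : Fin (suc n) → Fin m → Set
        Excess  u f = u ∈ edge f × topplings f is < suc q * occ u f is
        Deficit u f = u ∈ edge f × suc q * occ u f is < topplings f is

        excess⇒deficit : ∀ {u f} → Excess u f → ∃[ u′ ] Deficit u′ f
        excess⇒deficit {u} {f} (_ , T<rx)
          with sum-≡⇒∃< (edge-balance f is (size f)) u (≤-<-trans (⟦⟧*-≤ (u ∈? edge f) _) T<rx)
        ... | u′ , rx<T =
          u′ , ⟦⟧*-positive (u′ ∈? edge f) rx<T , <-≤-trans rx<T (⟦⟧*-≤ (u′ ∈? edge f) _)

        deficit⇒excess : ∀ {u f} → Deficit u f → ∃[ f′ ] Excess u f′
        deficit⇒excess {u} {f} (u∈f , rx<T)
          with sum-≡⇒∃< (sym (vertex-balance W u)) f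
                 (subst (suc q * occ u f is <_) (sym (⟦⟧*-true (u ∈? edge f) u∈f _)) rx<T)
        ... | f′ , T<rx with u ∈? edge f′
        ...   | yes u∈f′ =
          f′ , u∈f′ , subst (_< suc q * occ u f′ is) (*-identityˡ (topplings f′ is)) T<rx
        ...   | no u∉f′  =
          contradiction (subst (0 <_) (cong (suc q *_) (occ-∉ W u∉f′)) T<rx) (<-irrefl (sym (*-zeroʳ q)))

        noExcess : ∀ {u f} → ¬ Excess u f
        noExcess excess = acyclic⇒¬nonBacktrackingWalk acyclic
          (alternatingWalk Excess Deficit proj₁ proj₁ (λ (_ , T<rx) (_ , rx<T) → <-asym T<rx rx<T)
                           excess⇒deficit deficit⇒excess excess)

        occ-uniform : ∀ {e v} → v ∈ edge e → suc q * occ v e is ≡ topplings e is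
        occ-uniform {e} {v} v∈e =
          trans (sum-≡∧≤⇒≡ (edge-balance e is (size e)) bounded v)
                (⟦⟧*-true (v ∈? edge e) v∈e (topplings e is))
          where
          bounded : ∀ u → suc q * occ u e is ≤ ⟦ u ∈? edge e ⟧ * topplings e is
          bounded u with u ∈? edge e
          ... | yes u∈e = subst (suc q * occ u e is ≤_) (sym (*-identityˡ (topplings e is)))
                                (≮⇒≥ (λ T<rx → noExcess (u∈e , T<rx)))
          ... | no u∉e  = ≤-reflexive (trans (cong (suc q *_) (occ-∉ W u∉e)) (*-zeroʳ (suc q)))

mainTheorem7 : (r n m : ℕ) → 2 ≤ r →
    (edge : Fin m → Subset (suc n)) → IsRTree r n m edge →
    (_≻_ : Fin (suc n) → Fin (suc n) → Set) → IsStrictTotalOrder _≡_ _≻_ →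
    (α : Config n) → IsConfiguration r n α → Recurrent r edge _≻_ α →
    (e : Fin m) → (is : List (Incidence n m)) → ClosedWalk r edge _≻_ α is →
    ∀ (w w′ : Fin (suc n)) → w ∈ edge e → w′ ∈ edge e →
    occ w e is ≡ occ w′ e is
mainTheorem7 zero    _ _ () _
mainTheorem7 (suc q) _ _ _ edge tree _ _ _ _ _ e is (closed , _) w w′ w∈e w′∈e =
  *-cancelˡ-≡ (occ w e is) (occ w′ e is) (suc q) (trans (occ-uniform w∈e) (sym (occ-uniform w′∈e)))
  where
  open IsRTree tree using (edgeSize; acyclic)
  open OnClosedWalk edge q acyclic edgeSize closed
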